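{- Let $p$ be a prime, $N,\alpha_1\in\mathbb{Z}^+$, $\underline{\alpha}=(\alpha_1,\dots,\alpha_1)\in(\mathbb{Z}^+)^N$ (all entries equal), and $D\in\mathbb{N}$. Put $$Q:=\lfloor\log_p(D/N+1)\rfloor,\qquad R:=\Bigl\lfloor\frac{D-N(p^Q-1)}{(p-1)p^Q}\Bigr\rfloor.$$ Then $\mathcal{V}_p(\underline{\alpha},D)=\max\{N(\alpha_1-Q)-R,\,0\}$. In particular, if $\alpha_1=1$, then $\mathcal{V}_p(\underline{\alpha},D)=\max\bigl\{N-\lfloor D/(p-1)\rfloor,\,0\bigr\}$.
   Context: For $\underline{n}\in\mathbb{N}^N$, $\nu_p(\underline{\alpha},\underline{n}):=\sum_{i=1}^N\nu_p(\alpha_i,n_i)$ with $\nu_p(\alpha_i,n_i):=\alpha_i-\operatorname{ord}_p(n_i+1)$ if $n_i\le p^{\alpha_i}-1$ and $\infty$ otherwise ($\operatorname{ord}_p$ the $p$-adic valuation); equivalently $\nu_p(\alpha_i,n_i)=\operatorname{ord}_p\bigl(\sum_{x=0}^{p^{\alpha_i}-1}\binom{x}{n_i}\bigr)$. $\mathcal{V}_p(\underline{\alpha},D):=\min\{\nu_p(\underline{\alpha},\underline{n})\mid\underline{n}\in\mathbb{N}^N,\ n_1+\dots+n_N\le D\}$. -}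

module Defs where

open import Data.Nat using (ℕ; zero; suc; _+_; _*_; _∸_; _^_; _≤_; _<_; _<?_)
open import Data.Nat.DivMod using (_/_)
open import Data.Nat.Divisibility using (_∣?_)
open import Data.Maybe using (Maybe; just; nothing)
open import Data.Vec using (Vec; []; _∷_; sum; zipWith)
open import Data.Product using (Σ; _×_)
open import Data.Unit using (⊤)
open import Relation.Nullary using (yes; no)

-- floor division with the (irrelevant here) convention m div 0 = 0
_div_ : ℕ → ℕ → ℕ
m div zero = 0
m div suc k = m / suc k

-- p-adic valuation ord_p(m): number of times p divides m.
-- Computed with fuel m (sufficient for m ≥ 1, p ≥ 2, the only case used).
ordAux : ℕ → ℕ → ℕ → ℕ
ordAux p zero    m = 0
ordAux p (suc f) m with p ∣? m
... | yes _ = suc (ordAux p f (m div p))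
... | no  _ = 0

ord : ℕ → ℕ → ℕ
ord p m = ordAux p m m

-- extended naturals ℕ ∪ {∞}: nothing = ∞
ℕ∞ : Set
ℕ∞ = Maybe ℕ

_+∞_ : ℕ∞ → ℕ∞ → ℕ∞
just a +∞ just b = just (a + b)
_      +∞ _      = nothing

_≤∞_ : ℕ → ℕ∞ → Set
m ≤∞ just n  = m ≤ n
m ≤∞ nothing = ⊤

ν : (p α n : ℕ) → ℕ∞
ν p α n with n <? p ^ α
... | yes _ = just (α ∸ ord p (suc n))
... | no  _ = nothing

νsum : ∀ {N} → ℕ → Vec ℕ N → Vec ℕ N → ℕ∞
νsum p []       []       = just 0
νsum p (α ∷ αs) (n ∷ ns) = ν p α n +∞ νsum p αs ns

-- "𝒱_p(α̲, D) = v": v is the minimum of ν_p(α̲, n̲) over n̲ ∈ ℕ^N with n₁+…+n_N ≤ D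
-- (attained, and a lower bound for all such n̲).
VpIs : ∀ {N} → (p : ℕ) → Vec ℕ N → (D v : ℕ) → Set
VpIs {N} p α D v =
  Σ (Vec ℕ N) (λ n → sum n ≤ D × νsum p α n ≡ just v)
  × ((n : Vec ℕ N) → sum n ≤ D → v ≤∞ νsum p α n)
  where open import Relation.Binary.PropositionalEquality using (_≡_)

Rval : (p N D Q : ℕ) → ℕ
Rval p N D Q = (D ∸ N * (p ^ Q ∸ 1)) div ((p ∸ 1) * p ^ Q)

-- Put k_i = min(ord_p(n_i + 1), α), so that ν_p(α, n_i) = α − k_i and p^k_i ≤ n_i + 1.
-- By convexity, p^k ≥ p^Q + (k − Q)(p − 1)p^Q for every k; summing over the coordinates
-- and using Σ n_i ≤ D gives (Σ k_i − NQ)(p − 1)p^Q ≤ D − N(p^Q − 1), hence Σ k_i ≤ NQ + R.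
-- The bound is attained by R coordinates equal to p^(Q+1) − 1 and N − R equal to p^Q − 1
-- (R < N because D + N < N p^(Q+1)), or by all coordinates p^α − 1 when α ≤ Q. For α = 1
-- either N(p − 1) ≤ D and the minimum is 0, or Q = 0 works.

module Submission where

open import Defs
open import Data.Nat using (ℕ; zero; suc; _+_; _*_; _∸_; _^_; _≤_; _<_; z≤n; s≤s; _<?_; _≤?_; _⊓_)
open import Data.Nat.Properties
open import Data.Nat.DivMod using (_/_; m*n/n≡m; m/n*n≤m; /-monoˡ-≤; m<n*o⇒m/o<n)
open import Data.Nat.Divisibility using (_∣_; divides; _∣?_; 1∣_; ∣1⇒≡1; m∣m*n; ∣⇒≤; *-monoˡ-∣)
open import Data.Nat.Primality using (Prime)
open import Data.Nat.Tactic.RingSolver using (solve-∀)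
open import Data.Vec using (Vec; []; _∷_; sum; replicate)
open import Data.Maybe using (just; nothing)
open import Data.Product using (Σ; _×_; _,_)
open import Data.Sum using (inj₁; inj₂)
open import Data.Unit using (tt)
open import Data.Empty using (⊥-elim)
open import Relation.Nullary using (yes; no)
open import Relation.Binary.PropositionalEquality using (_≡_; refl; sym; trans; cong; cong₂; subst)

open ≤-Reasoning

*≤⇒≤div : ∀ {m c s} → 0 < c → s * c ≤ m → s ≤ m div c
*≤⇒≤div {m} {suc c} {s} _ s*c≤m = subst (_≤ m / suc c) (m*n/n≡m s (suc c)) (/-monoˡ-≤ (suc c) s*c≤m)

div*≤ : ∀ m c → m div c * c ≤ m
div*≤ m zero    = z≤n
div*≤ m (suc c) = m/n*n≤m m (suc c)

<*⇒div< : ∀ {m c n} → 0 < c → m < n * c → m div c < n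
<*⇒div< {c = suc c} _ = m<n*o⇒m/o<n

∸≤div : ∀ {a b m c} → 0 < c → a * c ≤ m + b * c → a ∸ b ≤ m div c
∸≤div {a} {b} {m} {c} c>0 le = *≤⇒≤div c>0 (begin
  (a ∸ b) * c    ≡⟨ *-distribʳ-∸ c a b ⟩
  a * c ∸ b * c  ≤⟨ m≤n+o⇒m∸n≤o (a * c) (b * c) (subst (a * c ≤_) (+-comm m (b * c)) le) ⟩
  m              ∎)

∸∸≤ : ∀ {x y w r} → x ∸ (y + w) ≤ r → x ∸ y ∸ r ≤ w
∸∸≤ {x} {y} {w} {r} le = m≤n+o⇒m∸n≤o (x ∸ y) r (begin
  x ∸ y            ≤⟨ m≤n+m∸n (x ∸ y) w ⟩
  w + (x ∸ y ∸ w)  ≡⟨ cong (w +_) (∸-+-assoc x y w) ⟩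
  w + (x ∸ (y + w)) ≤⟨ +-monoʳ-≤ w le ⟩
  w + r            ≡⟨ +-comm w r ⟩
  r + w            ∎)

sum-replicate : ∀ N α → sum (replicate N α) ≡ N * α
sum-replicate zero    α = refl
sum-replicate (suc N) α = cong (α +_) (sum-replicate N α)

+∞-just-inv : ∀ {x y w} → x +∞ y ≡ just w → Σ ℕ λ a → Σ ℕ λ b → x ≡ just a × y ≡ just b × a + b ≡ w
+∞-just-inv {just a} {just b} refl = a , b , refl , refl , refl

VpIs-intro : ∀ {N} p (αs : Vec ℕ N) D v (n : Vec ℕ N) → sum n ≤ D → νsum p αs n ≡ just v →
             (∀ (n′ : Vec ℕ N) {w} → sum n′ ≤ D → νsum p αs n′ ≡ just w → v ≤ w) →
             VpIs p αs D v
VpIs-intro p αs D v n Σn≤D νn≡v minimal = (n , Σn≤D , νn≡v) , bound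
  where
  bound : (n′ : Vec ℕ _) → sum n′ ≤ D → v ≤∞ νsum p αs n′
  bound n′ Σn′≤D with νsum p αs n′ in eq
  ... | just w  = minimal n′ Σn′≤D eq
  ... | nothing = tt

twoValued : ∀ N → ℕ → ℕ → ℕ → Vec ℕ N
twoValued zero    _       _ _ = []
twoValued (suc N) zero    x y = y ∷ twoValued N zero x y
twoValued (suc N) (suc r) x y = x ∷ twoValued N r x y

sum-twoValued : ∀ {N r} x y → r ≤ N → sum (twoValued N r x y) ≡ r * x + (N ∸ r) * y
sum-twoValued {zero}  x y z≤n = refl
sum-twoValued {suc N} x y z≤n = cong (y +_) (sum-twoValued {N} x y z≤n)
sum-twoValued {suc N} {suc r} x y (s≤s r≤N) =
  trans (cong (x +_) (sum-twoValued x y r≤N)) (sym (+-assoc x (r * x) _))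

twoLevel-value : ∀ {r N α Q} → r ≤ N → Q < α →
                 r * (α ∸ suc Q) + (N ∸ r) * (α ∸ Q) ≡ N * (α ∸ Q) ∸ r
twoLevel-value {r} {N} {suc α} {Q} r≤N (s≤s Q≤α) = begin-equality
  r * e + s * (suc α ∸ Q)    ≡⟨ cong (λ z → r * e + s * z) (+-∸-assoc 1 Q≤α) ⟩
  r * e + s * suc e          ≡⟨ sym (m+n∸m≡n r _) ⟩
  r + (r * e + s * suc e) ∸ r ≡⟨ cong (_∸ r) (regroup r s e) ⟩
  (r + s) * suc e ∸ r        ≡⟨ cong (λ z → z * suc e ∸ r) (m+[n∸m]≡n r≤N) ⟩
  N * suc e ∸ r              ≡⟨ cong (λ z → N * z ∸ r) (sym (+-∸-assoc 1 Q≤α)) ⟩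
  N * (suc α ∸ Q) ∸ r        ∎
  where
  e s : ℕ
  e = α ∸ Q
  s = N ∸ r
  regroup : ∀ r s e → r + (r * e + s * (1 + e)) ≡ (r + s) * (1 + e)
  regroup = solve-∀

-- The base is p = 2 + t.
module _ (t : ℕ) where
  private
    p q : ℕ
    p = suc (suc t)
    q = suc t

  1≤p^ : ∀ j → 1 ≤ p ^ j
  1≤p^ = m^n>0 p

  slope : ℕ → ℕ
  slope Q = q * p ^ Q

  0<slope : ∀ Q → 0 < slope Q
  0<slope Q = ≤-trans (1≤p^ Q) (m≤m+n (p ^ Q) (t * p ^ Q))

  bernoulli : ∀ j → 1 + j * q ≤ p ^ j
  bernoulli zero    = ≤-refl
  bernoulli (suc j) = begin
    1 + (q + j * q)  ≡⟨ cong suc (+-comm q (j * q)) ⟩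
    1 + j * q + q    ≤⟨ +-mono-≤ (bernoulli j) (subst (_≤ q * p ^ j) (*-identityʳ q) (*-monoʳ-≤ q (1≤p^ j))) ⟩
    p ^ j + q * p ^ j ∎

  -- Convexity of k ↦ p ^ k: at integers it lies above its secant through Q and Q + 1.
  tangent : ∀ Q k → p ^ Q + k * slope Q ≤ p ^ k + Q * slope Q
  tangent Q k with ≤-<-connex Q k
  ... | inj₁ Q≤k with m≤n⇒∃[o]m+o≡n Q≤k
  ...   | j , refl = begin
    p ^ Q + (Q + j) * slope Q             ≡⟨ regroup (p ^ Q) Q j q ⟩
    p ^ Q * (1 + j * q) + Q * slope Q     ≤⟨ +-monoˡ-≤ _ (*-monoʳ-≤ (p ^ Q) (bernoulli j)) ⟩
    p ^ Q * p ^ j + Q * slope Q           ≡⟨ cong (_+ Q * slope Q) (sym (^-distribˡ-+-* p Q j)) ⟩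
    p ^ (Q + j) + Q * slope Q             ∎
    where
    regroup : ∀ X Q j q → X + (Q + j) * (q * X) ≡ X * (1 + j * q) + Q * (q * X)
    regroup = solve-∀
  tangent Q k | inj₂ k<Q with m≤n⇒∃[o]m+o≡n k<Q
  ...   | j , refl = begin
    p ^ Q + k * c                 ≤⟨ +-monoˡ-≤ (k * c) (m≤m+n (p ^ Q) (t * p ^ Q)) ⟩
    c + k * c                     ≤⟨ +-monoˡ-≤ (k * c) (m≤m+n c (j * c)) ⟩
    c + j * c + k * c             ≡⟨ regroup c k j ⟩
    Q * c                         ≤⟨ m≤n+m (Q * c) (p ^ k) ⟩
    p ^ k + Q * c                 ∎
    where
    c : ℕ
    c = slope Q
    regroup : ∀ c k j → c + j * c + k * c ≡ (1 + k + j) * c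
    regroup = solve-∀

  p^ord∣ : ∀ f m → p ^ ordAux p f m ∣ m
  p^ord∣ zero    m = 1∣ m
  p^ord∣ (suc f) m with p ∣? m
  ... | no _ = 1∣ m
  ... | yes (divides k refl) = subst (λ z → p ^ suc (ordAux p f z) ∣ k * p) (sym (m*n/n≡m k p)) p^suc∣
    where
    p^ord∣k : p ^ ordAux p f k ∣ k
    p^ord∣k = subst (λ z → p ^ ordAux p f z ∣ z) (m*n/n≡m k p) (p^ord∣ f (k * p / p))
    p^suc∣ : p * p ^ ordAux p f k ∣ k * p
    p^suc∣ = subst (_∣ k * p) (*-comm (p ^ ordAux p f k) p) (*-monoˡ-∣ p p^ord∣k)

  ordAux-p^ : ∀ f j → j < f → ordAux p f (p ^ j) ≡ j
  ordAux-p^ (suc f) zero _ with p ∣? 1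
  ... | no _ = refl
  ... | yes p∣1 with ∣1⇒≡1 p∣1
  ...   | ()
  ordAux-p^ (suc f) (suc j) (s≤s j<f) with p ∣? p ^ suc j
  ... | yes _ = cong suc (trans (cong (ordAux p f) p*p^j/p) (ordAux-p^ f j j<f))
    where
    p*p^j/p : (p * p ^ j) / p ≡ p ^ j
    p*p^j/p = trans (cong (_/ p) (*-comm p (p ^ j))) (m*n/n≡m (p ^ j) p)
  ... | no p∤ = ⊥-elim (p∤ (m∣m*n (p ^ j)))

  ord-p^ : ∀ j → ord p (p ^ j) ≡ j
  ord-p^ j = ordAux-p^ (p ^ j) j (≤-trans (s≤s (m≤m*n j q)) (bernoulli j))

  ν-just⇒ : ∀ {α n a} → ν p α n ≡ just a → a ≡ α ∸ ord p (suc n)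
  ν-just⇒ {α} {n} eq with n <? p ^ α
  ν-just⇒ refl | yes _ = refl
  ν-just⇒ ()   | no _

  ν-p^∸1 : ∀ {α j} → j ≤ α → ν p α (p ^ j ∸ 1) ≡ just (α ∸ j)
  ν-p^∸1 {α} {j} j≤α with p ^ j ∸ 1 <? p ^ α
  ... | yes _   = cong (λ z → just (α ∸ z)) (trans (cong (ord p) suc[p^j∸1]) (ord-p^ j))
    where
    suc[p^j∸1] : suc (p ^ j ∸ 1) ≡ p ^ j
    suc[p^j∸1] = m+[n∸m]≡n (1≤p^ j)
  ... | no ≮p^α = ⊥-elim (≮p^α (≤-trans (≤-reflexive (m+[n∸m]≡n (1≤p^ j))) (^-monoʳ-≤ p j≤α)))

  ν-tangent : ∀ Q {α n a} → ν p α n ≡ just a → p ^ Q + α * slope Q ≤ suc n + (Q + a) * slope Q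
  ν-tangent Q {α} {n} {a} ν≡a = begin
    p ^ Q + α * c               ≡⟨ cong (λ z → p ^ Q + z * c) (sym k+a≡α) ⟩
    p ^ Q + (k + a) * c         ≡⟨ regroup (p ^ Q) k a c ⟩
    p ^ Q + k * c + a * c       ≤⟨ +-monoˡ-≤ (a * c) (tangent Q k) ⟩
    p ^ k + Q * c + a * c       ≤⟨ +-monoˡ-≤ (a * c) (+-monoˡ-≤ (Q * c) p^k≤1+n) ⟩
    suc n + Q * c + a * c       ≡⟨ sym (regroup (suc n) Q a c) ⟩
    suc n + (Q + a) * c         ∎
    where
    c o k : ℕ
    c = slope Q
    o = ord p (suc n)
    k = o ⊓ α
    k+a≡α : k + a ≡ α
    k+a≡α = subst (λ z → k + z ≡ α) (sym (ν-just⇒ ν≡a)) (m⊓n+n∸m≡n o α)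
    p^k≤1+n : p ^ k ≤ suc n
    p^k≤1+n = ≤-trans (^-monoʳ-≤ p (m⊓n≤m o α)) (∣⇒≤ (p^ord∣ (suc n) (suc n)))
    regroup : ∀ x k a c → x + (k + a) * c ≡ x + k * c + a * c
    regroup = solve-∀

  νsum-tangent : ∀ {N} Q (αs n : Vec ℕ N) {w} → νsum p αs n ≡ just w →
                 N * p ^ Q + sum αs * slope Q ≤ sum n + N + (N * Q + w) * slope Q
  νsum-tangent Q [] [] refl = z≤n
  νsum-tangent {suc N} Q (α ∷ αs) (m ∷ n) eq with +∞-just-inv eq
  ... | a , b , ν≡a , νsum≡b , refl = begin
    suc N * X + (α + sum αs) * c                       ≡⟨ split N X α (sum αs) c ⟩
    (X + α * c) + (N * X + sum αs * c)                 ≤⟨ +-mono-≤ (ν-tangent Q ν≡a) (νsum-tangent Q αs n νsum≡b) ⟩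
    (suc m + (Q + a) * c) + (sum n + N + (N * Q + b) * c) ≡⟨ merge m (sum n) N Q a b c ⟩
    m + sum n + suc N + (suc N * Q + (a + b)) * c      ∎
    where
    X c : ℕ
    X = p ^ Q
    c = slope Q
    split : ∀ N X α A c → (1 + N) * X + (α + A) * c ≡ (X + α * c) + (N * X + A * c)
    split = solve-∀
    merge : ∀ m s N Q a b c → (1 + m + (Q + a) * c) + (s + N + (N * Q + b) * c)
                              ≡ m + s + (1 + N) + ((1 + N) * Q + (a + b)) * c
    merge = solve-∀

  excess : ℕ → ℕ → ℕ → ℕ
  excess N D Q = D ∸ N * (p ^ Q ∸ 1)

  N*[p^Q∸1]≤D : ∀ {N D Q} → N * p ^ Q ≤ D + N → N * (p ^ Q ∸ 1) ≤ D
  N*[p^Q∸1]≤D {N} {D} {Q} lo = begin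
    N * (p ^ Q ∸ 1)   ≡⟨ *-distribˡ-∸ N (p ^ Q) 1 ⟩
    N * p ^ Q ∸ N * 1 ≡⟨ cong (N * p ^ Q ∸_) (*-identityʳ N) ⟩
    N * p ^ Q ∸ N     ≤⟨ ∸-monoˡ-≤ N lo ⟩
    D + N ∸ N         ≡⟨ m+n∸n≡m D N ⟩
    D                 ∎

  excess+N*p^Q : ∀ {N D Q} → N * p ^ Q ≤ D + N → excess N D Q + N * p ^ Q ≡ D + N
  excess+N*p^Q {N} {D} {Q} lo = begin-equality
    excess N D Q + N * p ^ Q                 ≡⟨ cong (λ z → excess N D Q + N * z) (sym (m∸n+n≡m (1≤p^ Q))) ⟩
    excess N D Q + N * (p ^ Q ∸ 1 + 1)       ≡⟨ cong (excess N D Q +_) (*-distribˡ-+ N (p ^ Q ∸ 1) 1) ⟩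
    excess N D Q + (N * (p ^ Q ∸ 1) + N * 1) ≡⟨ sym (+-assoc (excess N D Q) _ _) ⟩
    excess N D Q + N * (p ^ Q ∸ 1) + N * 1   ≡⟨ cong₂ _+_ (m∸n+n≡m (N*[p^Q∸1]≤D {N} {D} {Q} lo)) (*-identityʳ N) ⟩
    D + N                                    ∎

  Vp-lower : ∀ {N α D Q} → N * p ^ Q ≤ D + N → (n : Vec ℕ N) {w : ℕ} → sum n ≤ D →
             νsum p (replicate N α) n ≡ just w → N * (α ∸ Q) ∸ Rval p N D Q ≤ w
  Vp-lower {N} {α} {D} {Q} lo n {w} Σn≤D eq =
    subst (λ z → z ∸ Rval p N D Q ≤ w) (sym (*-distribˡ-∸ N α Q))
      (∸∸≤ {N * α} {N * Q} (∸≤div {N * α} {N * Q + w} (0<slope Q) (+-cancelˡ-≤ (N * p ^ Q) _ _ bound)))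
    where
    e c : ℕ
    e = excess N D Q
    c = slope Q
    bound : N * p ^ Q + N * α * c ≤ N * p ^ Q + (e + (N * Q + w) * c)
    bound = begin
      N * p ^ Q + N * α * c                    ≡⟨ cong (λ z → N * p ^ Q + z * c) (sym (sum-replicate N α)) ⟩
      N * p ^ Q + sum (replicate N α) * c      ≤⟨ νsum-tangent Q (replicate N α) n eq ⟩
      sum n + N + (N * Q + w) * c              ≤⟨ +-monoˡ-≤ _ (+-monoˡ-≤ N Σn≤D) ⟩
      D + N + (N * Q + w) * c                  ≡⟨ cong (_+ (N * Q + w) * c) (sym (excess+N*p^Q {N} {D} {Q} lo)) ⟩
      e + N * p ^ Q + (N * Q + w) * c          ≡⟨ cong (_+ (N * Q + w) * c) (+-comm e (N * p ^ Q)) ⟩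
      N * p ^ Q + e + (N * Q + w) * c          ≡⟨ +-assoc (N * p ^ Q) e _ ⟩
      N * p ^ Q + (e + (N * Q + w) * c)        ∎

  νsum-twoValued : ∀ {N r α x y a b} → r ≤ N → ν p α x ≡ just a → ν p α y ≡ just b →
                   νsum p (replicate N α) (twoValued N r x y) ≡ just (r * a + (N ∸ r) * b)
  νsum-twoValued {zero}  z≤n _ _ = refl
  νsum-twoValued {suc N} z≤n νx νy rewrite νy | νsum-twoValued {N} z≤n νx νy = refl
  νsum-twoValued {suc N} {suc r} {a = a} {b} (s≤s r≤N) νx νy rewrite νx | νsum-twoValued r≤N νx νy =
    cong just (sym (+-assoc a (r * a) ((N ∸ r) * b)))

  Vp-saturated : ∀ {N α D} → N * (p ^ α ∸ 1) ≤ D → VpIs p (replicate N α) D 0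
  Vp-saturated {N} {α} {D} le =
    VpIs-intro p (replicate N α) D 0 w (subst (_≤ D) (sym (sum-twoValued {N} y y z≤n)) le) νw (λ _ _ _ → z≤n)
    where
    y : ℕ
    y = p ^ α ∸ 1
    w : Vec ℕ N
    w = twoValued N 0 y y
    ν-y : ν p α y ≡ just (α ∸ α)
    ν-y = ν-p^∸1 ≤-refl
    νw : νsum p (replicate N α) w ≡ just 0
    νw = trans (νsum-twoValued {N} z≤n ν-y ν-y) (cong just (trans (cong (N *_) (n∸n≡0 α)) (*-zeroʳ N)))

  Vp-unsaturated : ∀ {N α D Q} → Q < α → N * p ^ Q ≤ D + N → D + N < N * p ^ suc Q →
                   VpIs p (replicate N α) D (N * (α ∸ Q) ∸ Rval p N D Q)
  Vp-unsaturated {N} {α} {D} {Q} Q<α lo hi = VpIs-intro p (replicate N α) D _ w Σw≤D νw (Vp-lower {N} {α} {D} {Q} lo)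
    where
    R e c x y : ℕ
    R = Rval p N D Q
    e = excess N D Q
    c = slope Q
    x = p ^ suc Q ∸ 1
    y = p ^ Q ∸ 1
    R<N : R < N
    R<N = <*⇒div< (0<slope Q) (+-cancelˡ-< (N * p ^ Q) _ _ (begin-strict
      N * p ^ Q + e     ≡⟨ +-comm (N * p ^ Q) e ⟩
      e + N * p ^ Q     ≡⟨ excess+N*p^Q {N} {D} {Q} lo ⟩
      D + N             <⟨ hi ⟩
      N * p ^ suc Q     ≡⟨ *-distribˡ-+ N (p ^ Q) c ⟩
      N * p ^ Q + N * c ∎))
    w : Vec ℕ N
    w = twoValued N R x y
    νw : νsum p (replicate N α) w ≡ just (N * (α ∸ Q) ∸ R)
    νw = trans (νsum-twoValued (<⇒≤ R<N) (ν-p^∸1 {α} {suc Q} Q<α) (ν-p^∸1 {α} {Q} (<⇒≤ Q<α)))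
               (cong just (twoLevel-value {α = α} (<⇒≤ R<N) Q<α))
    Σw≤D : sum w ≤ D
    Σw≤D = begin
      sum w                      ≡⟨ sum-twoValued {N} x y (<⇒≤ R<N) ⟩
      R * x + (N ∸ R) * y        ≡⟨ cong (λ z → R * z + (N ∸ R) * y) (+-∸-comm c (1≤p^ Q)) ⟩
      R * (y + c) + (N ∸ R) * y  ≡⟨ regroup R (N ∸ R) y c ⟩
      (R + (N ∸ R)) * y + R * c  ≡⟨ cong (λ z → z * y + R * c) (m+[n∸m]≡n (<⇒≤ R<N)) ⟩
      N * y + R * c              ≤⟨ +-monoʳ-≤ (N * y) (div*≤ e c) ⟩
      N * y + e                  ≡⟨ +-comm (N * y) e ⟩
      e + N * y                  ≡⟨ m∸n+n≡m (N*[p^Q∸1]≤D {N} {D} {Q} lo) ⟩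
      D                          ∎
      where
      regroup : ∀ R s y c → R * (y + c) + s * y ≡ (R + s) * y + R * c
      regroup = solve-∀

  Vp-formula : ∀ N α D Q → N * p ^ Q ≤ D + N → D + N < N * p ^ suc Q →
               VpIs p (replicate N α) D (N * (α ∸ Q) ∸ Rval p N D Q)
  Vp-formula N α D Q lo hi with α ≤? Q
  ... | no α≰Q  = Vp-unsaturated (≰⇒> α≰Q) lo hi
  ... | yes α≤Q = subst (VpIs p (replicate N α) D) (sym vanishes)
                    (Vp-saturated (≤-trans (*-monoʳ-≤ N (∸-monoˡ-≤ 1 (^-monoʳ-≤ p α≤Q))) (N*[p^Q∸1]≤D {N} {D} {Q} lo)))
    where
    vanishes : N * (α ∸ Q) ∸ Rval p N D Q ≡ 0
    vanishes = begin-equality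
      N * (α ∸ Q) ∸ Rval p N D Q ≡⟨ cong (λ z → N * z ∸ Rval p N D Q) (m≤n⇒m∸n≡0 α≤Q) ⟩
      N * 0 ∸ Rval p N D Q       ≡⟨ cong (_∸ Rval p N D Q) (*-zeroʳ N) ⟩
      0 ∸ Rval p N D Q           ≡⟨ 0∸n≡0 (Rval p N D Q) ⟩
      0                          ∎

  Vp-formula-α≡1 : ∀ N D → VpIs p (replicate N 1) D (N ∸ D div q)
  Vp-formula-α≡1 N D with N * q ≤? D
  ... | yes N*q≤D = subst (VpIs p (replicate N 1) D) (sym (m≤n⇒m∸n≡0 (*≤⇒≤div (s≤s z≤n) N*q≤D)))
                      (Vp-saturated (subst (_≤ D) (cong (N *_) (sym (*-identityʳ q))) N*q≤D))
  ... | no N*q≰D  = subst (VpIs p (replicate N 1) D) value (Vp-formula N 1 D 0 lo hi)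
    where
    lo : N * 1 ≤ D + N
    lo = ≤-trans (≤-reflexive (*-identityʳ N)) (m≤n+m N D)
    hi : D + N < N * (p * 1)
    hi = begin-strict
      D + N         <⟨ +-monoˡ-< N (≰⇒> N*q≰D) ⟩
      N * q + N     ≡⟨ +-comm (N * q) N ⟩
      N + N * q     ≡⟨ sym (*-suc N q) ⟩
      N * p         ≡⟨ cong (N *_) (sym (*-identityʳ p)) ⟩
      N * (p * 1)   ∎
    value : N * 1 ∸ (D ∸ N * 0) div (q * 1) ≡ N ∸ D div q
    value = cong₂ _∸_ (*-identityʳ N) (cong₂ _div_ (cong (D ∸_) (*-zeroʳ N)) (*-identityʳ q))

corollary4p5 : ((p N α₁ D : ℕ) → Prime p → 1 ≤ N → 1 ≤ α₁ →
                   (Q : ℕ) → N * p ^ Q ≤ D + N → D + N < N * p ^ suc Q →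
                   VpIs p (replicate N α₁) D (N * (α₁ ∸ Q) ∸ Rval p N D Q))
                 × ((p N α₁ D : ℕ) → Prime p → 1 ≤ N → α₁ ≡ 1 →
                   VpIs p (replicate N α₁) D (N ∸ D div (p ∸ 1)))
corollary4p5 =
    (λ { 0 _ _ _ () ; 1 _ _ _ () ; (suc (suc t)) N α₁ D _ _ _ Q → Vp-formula t N α₁ D Q })
  , (λ { 0 _ _ _ () ; 1 _ _ _ () ; (suc (suc t)) N _ D _ _ refl → Vp-formula-α≡1 t N D })
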